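{- Let $q$ be a prime power. In $\Lambda_{5,q}$ there is a cycle of type $(u_1,v_1,\dots,u_5,v_5)$ with $(v_1+v_5)(v_1+v_2)\ne0$ and $v_5=v_2+v_3$ if and only if there exist $b,c,r\in\mathbb{F}_q^*$ with $c\notin\{ -b,-2b\}$ such that $v_1=-2b-c$, $v_2=b$, $v_3=c$, $v_4=-c$, $v_5=b+c$ and $u_1=cr$, $u_2=-cr$, $u_3=(b+c)r$, $u_4=-(2b+c)r$, $u_5=br$.
   Context: For a prime power $q$ and integer $k\ge2$, $\Lambda_{k,q}$ is the bipartite graph with vertex set $L_k\cup R_k$ (regarded as disjoint), where $L_k$ is the set of vectors $[l]=(l_0,\dots,l_k)\in\mathbb{F}_q^{k+1}$ with $l_1=l_2$ and $R_k$ the set of vectors $\langle r\rangle=(r_0,\dots,r_k)\in\mathbb{F}_q^{k+1}$ with $r_1=0$; edges join only $L_k$ to $R_k$, and $[l]\sim\langle r\rangle$ iff for every $2\le i\le k$: $l_i+r_i=r_0l_{i-2}$ if $i\equiv2,3\pmod4$, and $l_i+r_i=l_0r_{i-2}$ if $i\equiv0,1\pmod4$. A cycle of length $2n$ through the edge joining the two all-zero vectors is written $[l^{(1)}],\langle r^{(1)}\rangle,\dots,[l^{(n)}],\langle r^{(n)}\rangle$ (distinct vertices, consecutive ones adjacent, $\langle r^{(n)}\rangle\sim[l^{(1)}]$) with $[l^{(1)}]$ and $\langle r^{(1)}\rangle$ the all-zero vectors. Put $x_i=l^{(i)}_0$, $y_i=r^{(i)}_0$ ($1\le i\le n$), $x_{n+1}=y_{n+1}=0$,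 $u_i=x_{i+1}-x_i$, $v_i=y_{i+1}-y_i$; the tuple $(u_1,v_1,\dots,u_n,v_n)$ is the type of the cycle, and "there is a cycle of type $\epsilon$" means such a cycle with type $\epsilon$ exists. -}

module Defs where

open import Level using (0ℓ)
open import Data.Nat as ℕ using (ℕ; zero; suc; _≤_; _%_)
open import Data.Nat.Primality using (Prime)
open import Data.Fin using (Fin; toℕ) renaming (zero to fzero; suc to fsuc)
open import Data.Vec using (Vec; []; _∷_; lookup; replicate)
open import Data.Product using (Σ; ∃; _×_; _,_)
open import Data.Empty using (⊥)
open import Relation.Nullary using (¬_)
open import Relation.Binary.PropositionalEquality using (_≡_; _≢_)
open import Algebra.Core using (Op₁; Op₂)
open import Algebra.Structures using (IsCommutativeRing)
open import Function.Bundles using (_↔_)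
open import Function.Definitions using (Injective)

IsPrimePower : ℕ → Set
IsPrimePower q = Σ ℕ λ p → Σ ℕ λ m → Prime p × 1 ≤ m × q ≡ p ℕ.^ m

record FiniteField (q : ℕ) : Set₁ where
  field
    Carrier : Set
    _+_ _*_ : Op₂ Carrier
    -_ : Op₁ Carrier
    0# 1# : Carrier
    isCommutativeRing : IsCommutativeRing _≡_ _+_ _*_ -_ 0# 1#
    0≢1 : 0# ≢ 1#
    inverse : ∀ x → x ≢ 0# → Σ Carrier λ y → x * y ≡ 1#
    enumeration : Carrier ↔ Fin q

  infixl 7 _*_
  infixl 6 _+_ _-_
  infix 8 -_

  _-_ : Op₂ Carrier
  x - y = x + (- y)

module Lambda {q : ℕ} (F : FiniteField q) where
  open FiniteField F public

  -- coordinate i of a vector (0# if out of range; never used out of range below)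
  at : ∀ {n} → Vec Carrier n → ℕ → Carrier
  at []       _       = 0#
  at (x ∷ _)  zero    = x
  at (_ ∷ xs) (suc i) = at xs i

  zeroVec : ∀ {n} → Vec Carrier n
  zeroVec = replicate _ 0#

  InL : ∀ {k} → Vec Carrier (suc k) → Set
  InL l = at l 1 ≡ at l 2

  InR : ∀ {k} → Vec Carrier (suc k) → Set
  InR r = at r 1 ≡ 0#

  data Kind : Set where
    k23 k01 : Kind

  kind : ℕ → Kind
  kind i with i % 4
  ... | 2 = k23
  ... | 3 = k23
  ... | _ = k01

  coordEq : ∀ {k} → Vec Carrier (suc k) → Vec Carrier (suc k) → ℕ → Kind → Set
  coordEq l r i k23 = at l i + at r i ≡ at r 0 * at l (i ℕ.∸ 2)
  coordEq l r i k01 = at l i + at r i ≡ at l 0 * at r (i ℕ.∸ 2)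

  Adj : ∀ k → Vec Carrier (suc k) → Vec Carrier (suc k) → Set
  Adj k l r = ∀ i → 2 ≤ i → i ≤ k → coordEq l r i (kind i)

  -- successor index in Fin (suc m), wrapping around (only last wraps)
  next : ∀ {m} → Fin (suc m) → Fin (suc m)
  next {zero}  fzero = fzero
  next {suc m} fzero = fsuc fzero
  next {suc m} (fsuc i) with next {m} i
  ... | fzero  = fzero
  ... | fsuc j = fsuc (fsuc j)

  isLast : ∀ {m} → Fin (suc m) → Set
  isLast {m} i = toℕ i ≡ m

  -- A cycle [l⁽¹⁾],⟨r⁽¹⁾⟩,…,[l⁽ⁿ⁾],⟨r⁽ⁿ⁾⟩ of length 2n (n = suc m) in Λ_{k,q}
  -- with [l⁽¹⁾] = ⟨r⁽¹⁾⟩ = all-zero vectors (indices 0..m stand for 1..n).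
  record Cycle (k m : ℕ) (ls rs : Fin (suc m) → Vec Carrier (suc k)) : Set where
    field
      inL     : ∀ i → InL (ls i)
      inR     : ∀ i → InR (rs i)
      l1-zero : ls fzero ≡ zeroVec
      r1-zero : rs fzero ≡ zeroVec
      adj-lr  : ∀ i → Adj k (ls i) (rs i)
      adj-rl  : ∀ i → Adj k (ls (next i)) (rs i)
      ls-distinct : Injective _≡_ _≡_ ls
      rs-distinct : Injective _≡_ _≡_ rs

  nextVal : ∀ {m} → (Fin (suc m) → Carrier) → Fin (suc m) → Carrier
  nextVal {m} x i with toℕ i ℕ.≟ m
  ... | Relation.Nullary.yes _ = 0#
  ... | Relation.Nullary.no _  = x (next i)

  uOf vOf : ∀ {k m} → (Fin (suc m) → Vec Carrier (suc k)) → Fin (suc m) → Carrier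
  uOf ls i = nextVal (λ j → at (ls j) 0) i - at (ls i) 0
  vOf rs i = nextVal (λ j → at (rs j) 0) i - at (rs i) 0

  HasCycleOfType : ∀ k m → Vec Carrier (suc m) → Vec Carrier (suc m) → Set
  HasCycleOfType k m us vs =
    Σ (Fin (suc m) → Vec Carrier (suc k)) λ ls →
    Σ (Fin (suc m) → Vec Carrier (suc k)) λ rs →
      Cycle k m ls rs × (∀ i → uOf ls i ≡ lookup us i) × (∀ i → vOf rs i ≡ lookup vs i)

{-# OPTIONS --safe #-}
module Submission where

-- A vertex of Λ₅ is determined by any one of its neighbours together with its own
-- first coordinate. So a 10-cycle through the edge joining the two zero vertices is
-- the walk from the origin fixed by the first coordinates x₂,…,x₅, y₂,…,y₅, and it
-- closes up exactly when coordinates 2–5 of its last right vertex vanish.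
-- Under v₅ = v₂ + v₃, i.e. y₅ = y₂ − y₄, two combinations of these four polynomial
-- conditions read  y₃x₃p + δx₄q = 0  and  y₃x₃²p + δx₄²q = 0,  where p = y₃ − y₂,
-- q = y₄ − y₃ and δ = y₃ + y₄ − y₂. Distinct vertices with a common neighbour have
-- distinct first coordinates, so p, q and x₃ − x₄ are nonzero, and y₃ ≠ 0 because
-- (v₁ + v₅)(v₁ + v₂) = y₄y₃. Eliminating gives δ = 0 and x₃ = 0; the remaining
-- conditions then factor as  q(y₄x₄ + y₃x₅)(x₄ − x₅) = 0  together with a linear
-- relation for x₂, and all coordinates become those of the standard cycle with
-- b = −y₄, c = y₄ − y₃, r = x₅/y₄. Conversely that walk closes up for all b, c, r,
-- and its vertices are distinct as soon as b, c, r, b + c and 2b + c are nonzero.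

open import Defs
open import Data.Nat using (ℕ)
open import Data.Vec using (_∷_; [])
open import Data.Product using (Σ; _×_)
open import Relation.Binary.PropositionalEquality using (_≡_; _≢_)
open import Function.Bundles using (_⇔_)

open import Algebra.Bundles using (CommutativeRing)
open import Algebra.Bundles.Raw using (RawRing)
open import Algebra.Solver.Ring.AlmostCommutativeRing
  using (fromCommutativeRing; _-Raw-AlmostCommutative⟶_; Induced-equivalence)
open import Data.Fin using (Fin)
open import Data.Fin.Patterns using (0F; 1F; 2F; 3F; 4F; 5F; 6F)
import Data.Integer as Int
open Int using (ℤ; -[1+_]; _⊖_)
import Data.Integer.Properties as Intₚ
open import Data.Maybe using (just; nothing)
open import Data.Nat as ℕ using (zero; suc; s≤s)
import Data.Nat.Properties as ℕₚ
open ℕₚ using (≤ᵇ⇒≤)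
open import Data.Product using (_,_; Σ-syntax; proj₁; proj₂; uncurry)
open import Data.Vec using (Vec; lookup; replicate; tabulate)
open import Data.Vec.Properties using (lookup∘tabulate; tabulate∘lookup; tabulate-cong)
open import Data.Vec.Relation.Binary.Pointwise.Inductive using (Pointwise-≡⇒≡; _∷_; [])
open import Data.Vec.Relation.Unary.All using (_∷_; [])
open import Data.Vec.Relation.Unary.AllPairs using (_∷_; [])
open import Data.Vec.Relation.Unary.Unique.Propositional using (Unique)
open import Data.Vec.Relation.Unary.Unique.Propositional.Properties using (lookup-injective)
open import Function using (_∘_; case_of_)
open import Function.Bundles using (mk⇔; Equivalence)
open import Function.Definitions using (Injective)
open import Level using (Level; 0ℓ)
open import Relation.Binary.Definitions using (WeaklyDecidable)
import Relation.Binary.PropositionalEquality as ≡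
open import Relation.Nullary using (yes; no)

module _ {a : Level} {A : Set a} where
  open ≡ using (sym; trans; cong)

  lookup-≡ : ∀ {n} {f : Fin n → A} {v} → tabulate f ≡ v → ∀ i → f i ≡ lookup v i
  lookup-≡ {f = f} eq i = trans (sym (lookup∘tabulate f i)) (cong (λ w → lookup w i) eq)

  tabulate-≡ : ∀ {n} {f : Fin n → A} {v} → (∀ i → f i ≡ lookup v i) → tabulate f ≡ v
  tabulate-≡ {v = v} eq = trans (tabulate-cong eq) (tabulate∘lookup v)

  tabulate-unique⇒injective : ∀ {n} {f : Fin n → A} → Unique (tabulate f) → Injective _≡_ _≡_ f
  tabulate-unique⇒injective {f = f} unique {i} {j} fi≡fj = lookup-injective unique i j
    (trans (lookup∘tabulate f i) (trans fi≡fj (sym (lookup∘tabulate f j))))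

-- The ring solver with integer coefficients. With the ring itself as coefficients,
-- as in Tactic.RingSolver, normal forms over an abstract ring cannot even cancel x - x.
module IntegerCoefficients {c ℓ} (R : CommutativeRing c ℓ) where
  open CommutativeRing R
  open Int using (+_)
  open import Algebra.Properties.Ring ring using (-0#≈0#; -‿involutive; -‿distribˡ-*; -‿distribʳ-*)
  open import Algebra.Properties.AbelianGroup +-abelianGroup using (⁻¹-∙-comm)
  open import Algebra.Properties.CommutativeSemigroup +-commutativeSemigroup using (interchange)
  open import Algebra.Properties.Semiring.Mult semiring using (×-homo-+; ×1-homo-*) renaming (_×_ to _·_)
  open import Relation.Binary.Reasoning.Setoid setoid

  fromℤ : ℤ → Carrier
  fromℤ (+ n)    = n · 1#
  fromℤ -[1+ n ] = - (suc n · 1#)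

  fromℤ-neg : ∀ i → fromℤ (Int.- i) ≈ - fromℤ i
  fromℤ-neg (+ zero)  = sym -0#≈0#
  fromℤ-neg (+ suc n) = refl
  fromℤ-neg -[1+ n ]  = sym (-‿involutive _)

  fromℤ-⊖ : ∀ m n → fromℤ (m ⊖ n) ≈ m · 1# - n · 1#
  fromℤ-⊖ m       zero    = sym (trans (+-congˡ -0#≈0#) (+-identityʳ _))
  fromℤ-⊖ zero    (suc n) = sym (+-identityˡ _)
  fromℤ-⊖ (suc m) (suc n) = begin
    fromℤ (suc m ⊖ suc n)           ≡⟨ ≡.cong fromℤ (Intₚ.[1+m]⊖[1+n]≡m⊖n m n) ⟩
    fromℤ (m ⊖ n)                   ≈⟨ fromℤ-⊖ m n ⟩
    m · 1# - n · 1#                 ≈⟨ +-identityˡ _ ⟨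
    0# + (m · 1# - n · 1#)          ≈⟨ +-congʳ (-‿inverseʳ 1#) ⟨
    (1# - 1#) + (m · 1# - n · 1#)   ≈⟨ interchange 1# (- 1#) (m · 1#) (- (n · 1#)) ⟩
    (1# + m · 1#) + (- 1# - n · 1#) ≈⟨ +-congˡ (⁻¹-∙-comm 1# (n · 1#)) ⟩
    (1# + m · 1#) - (1# + n · 1#)   ∎

  fromℤ-+ : ∀ i j → fromℤ (i Int.+ j) ≈ fromℤ i + fromℤ j
  fromℤ-+ (+ m)    (+ n)    = ×-homo-+ 1# m n
  fromℤ-+ (+ m)    -[1+ n ] = fromℤ-⊖ m (suc n)
  fromℤ-+ -[1+ m ] (+ n)    = trans (fromℤ-⊖ n (suc m)) (+-comm _ _)
  fromℤ-+ -[1+ m ] -[1+ n ] = begin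
    - (suc (suc (m ℕ.+ n)) · 1#) ≡⟨ ≡.cong (λ k → - (k · 1#)) (ℕₚ.+-suc (suc m) n) ⟨
    - ((suc m ℕ.+ suc n) · 1#)   ≈⟨ -‿cong (×-homo-+ 1# (suc m) (suc n)) ⟩
    - (suc m · 1# + suc n · 1#)  ≈⟨ ⁻¹-∙-comm _ _ ⟨
    - (suc m · 1#) - suc n · 1#  ∎

  fromℤ-*⁺ : ∀ m j → fromℤ (+ m Int.* j) ≈ m · 1# * fromℤ j
  fromℤ-*⁺ m (+ n)    = trans (reflexive (≡.cong fromℤ (≡.sym (Intₚ.pos-* m n)))) (×1-homo-* m n)
  fromℤ-*⁺ m -[1+ n ] = begin
    fromℤ (+ m Int.* Int.- + suc n)   ≡⟨ ≡.cong fromℤ (Intₚ.neg-distribʳ-* (+ m) (+ suc n)) ⟨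
    fromℤ (Int.- (+ m Int.* + suc n)) ≈⟨ fromℤ-neg (+ m Int.* + suc n) ⟩
    - fromℤ (+ m Int.* + suc n)     ≈⟨ -‿cong (fromℤ-*⁺ m (+ suc n)) ⟩
    - (m · 1# * suc n · 1#)       ≈⟨ -‿distribʳ-* _ _ ⟩
    m · 1# * - (suc n · 1#)       ∎

  fromℤ-* : ∀ i j → fromℤ (i Int.* j) ≈ fromℤ i * fromℤ j
  fromℤ-* (+ m)    j = fromℤ-*⁺ m j
  fromℤ-* -[1+ m ] j = begin
    fromℤ (Int.- + suc m Int.* j)     ≡⟨ ≡.cong fromℤ (Intₚ.neg-distribˡ-* (+ suc m) j) ⟨
    fromℤ (Int.- (+ suc m Int.* j))   ≈⟨ fromℤ-neg (+ suc m Int.* j) ⟩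
    - fromℤ (+ suc m Int.* j)       ≈⟨ -‿cong (fromℤ-*⁺ (suc m) j) ⟩
    - (suc m · 1# * fromℤ j)      ≈⟨ -‿distribˡ-* _ _ ⟩
    - (suc m · 1#) * fromℤ j      ∎

  homomorphism : Int.+-*-rawRing -Raw-AlmostCommutative⟶ fromCommutativeRing R
  homomorphism = record
    { ⟦_⟧    = fromℤ
    ; +-homo = fromℤ-+
    ; *-homo = fromℤ-*
    ; -‿homo = fromℤ-neg
    ; 0-homo = refl
    ; 1-homo = +-identityʳ 1#
    }

  _≟_ : WeaklyDecidable (Induced-equivalence homomorphism)
  i ≟ j with i Int.≟ j
  ... | yes ≡.refl = just refl
  ... | no _       = nothing

  open import Algebra.Solver.Ring Int.+-*-rawRing (fromCommutativeRing R) homomorphism _≟_ public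

module Neighbours {c ℓ} (R : RawRing c ℓ) where
  open RawRing R

  infixl 6 _-_
  _-_ : Carrier → Carrier → Carrier
  x - y = x + - y

  origin : Vec Carrier 6
  origin = replicate 6 0#

  -- Written with lookup rather than by matching on the vector, so that the walks
  -- below do not unfold into exponentially large terms during type checking.
  lNeighbour : Vec Carrier 6 → Carrier → Vec Carrier 6
  lNeighbour r x = x ∷ l₂ ∷ l₂ ∷ lookup r 0F * l₂ - lookup r 3F
                     ∷ x * lookup r 2F - lookup r 4F ∷ x * lookup r 3F - lookup r 5F ∷ []
    where l₂ = lookup r 0F * x - lookup r 2F

  rNeighbour : Vec Carrier 6 → Carrier → Vec Carrier 6
  rNeighbour l y = y ∷ 0# ∷ r₂ ∷ r₃ ∷ lookup l 0F * r₂ - lookup l 4F ∷ lookup l 0F * r₃ - lookup l 5F ∷ []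
    where r₂ = y * lookup l 0F - lookup l 2F
          r₃ = y * lookup l 1F - lookup l 3F

  -- lᵢ and rᵢ are the paper's [l⁽ⁱ⁾] and ⟨r⁽ⁱ⁾⟩, with first coordinates xᵢ and yᵢ
  -- taken from xs and ys; the walk starts at the zero vertices, so x₁, y₁ are ignored.
  module Walk (xs ys : Vec Carrier 5) where
    l₂ r₂ l₃ r₃ l₄ r₄ l₅ r₅ : Vec Carrier 6
    l₂ = lNeighbour origin (lookup xs 1F)
    r₂ = rNeighbour l₂ (lookup ys 1F)
    l₃ = lNeighbour r₂ (lookup xs 2F)
    r₃ = rNeighbour l₃ (lookup ys 2F)
    l₄ = lNeighbour r₃ (lookup xs 3F)
    r₄ = rNeighbour l₄ (lookup ys 3F)
    l₅ = lNeighbour r₄ (lookup xs 4F)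
    r₅ = rNeighbour l₅ (lookup ys 4F)

    ls rs : Fin 5 → Vec Carrier 6
    ls 0F = origin
    ls 1F = l₂
    ls 2F = l₃
    ls 3F = l₄
    ls 4F = l₅
    rs 0F = origin
    rs 1F = r₂
    rs 2F = r₃
    rs 3F = r₄
    rs 4F = r₅

  endpoint : Vec Carrier 5 → Vec Carrier 5 → Vec Carrier 6
  endpoint xs ys = Walk.r₅ xs ys

  standardX standardY : Carrier → Carrier → Carrier → Vec Carrier 5
  standardX b c r = 0# ∷ c * r ∷ 0# ∷ (b + c) * r ∷ - (b * r) ∷ []
  standardY b c r = 0# ∷ - (b + c) + - b ∷ - (b + c) ∷ - b ∷ - (b + c) ∷ []

  module Standard (b c r : Carrier) = Walk (standardX b c r) (standardY b c r)

module Λ₅ {q : ℕ} (F : FiniteField q) where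
  open Lambda F

  ring : CommutativeRing 0ℓ 0ℓ
  ring = record { isCommutativeRing = isCommutativeRing }

  open CommutativeRing ring
    using (rawRing; +-comm; +-identityˡ; +-identityʳ; -‿inverseʳ; *-comm; *-assoc; *-identityˡ; zeroˡ; zeroʳ
          ; *-commutativeSemigroup)
  open import Algebra.Properties.AbelianGroup (CommutativeRing.+-abelianGroup ring)
    using (quasigroup; inverseˡ-unique; inverseʳ-unique; ⁻¹-involutive; ε⁻¹≈ε
          ; x∙y⁻¹≈ε⇒x≈y; x≈y⇒x∙y⁻¹≈ε; //-rightDividesˡ; //-rightDividesʳ)
  open import Algebra.Properties.Quasigroup quasigroup using (x≈z//y)
  open import Algebra.Properties.CommutativeSemigroup *-commutativeSemigroup using (xy∙z≈y∙xz)
  open IntegerCoefficients ring using (Polynomial; var; con; _:+_; _:*_; :-_; _:-_; _:=_; solve; prove)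
  open ≡ using (refl; sym; trans; cong; cong₂; subst; subst₂; ≢-sym)
  open ≡.≡-Reasoning

  :0 : ∀ {n} → Polynomial n
  :0 = con (Int.+ 0)

  polynomials : ℕ → RawRing 0ℓ 0ℓ
  polynomials n = record
    { Carrier = Polynomial n ; _≈_ = _≡_
    ; _+_ = _:+_ ; _*_ = _:*_ ; -_ = :-_ ; 0# = :0 ; 1# = con (Int.+ 1) }

  open Neighbours rawRing
    using (origin; lNeighbour; rNeighbour; module Walk; endpoint; standardX; standardY; module Standard)
  -- Evaluating the formal constructions gives the ones in F definitionally, which
  -- is how the solver reaches coordinates of walks.
  module Formal {n} = Neighbours (polynomials n)

  xy≡0⇒y≡0 : ∀ {x y} → x ≢ 0# → x * y ≡ 0# → y ≡ 0#
  xy≡0⇒y≡0 {x} {y} x≢0 xy≡0 with inverse x x≢0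
  ... | x⁻¹ , xx⁻¹≡1 = begin
    y              ≡⟨ *-identityˡ y ⟨
    1# * y         ≡⟨ cong (_* y) xx⁻¹≡1 ⟨
    x * x⁻¹ * y    ≡⟨ xy∙z≈y∙xz x x⁻¹ y ⟩
    x⁻¹ * (x * y)  ≡⟨ cong (x⁻¹ *_) xy≡0 ⟩
    x⁻¹ * 0#       ≡⟨ zeroʳ x⁻¹ ⟩
    0#             ∎

  xy≡0⇒x≡0 : ∀ {x y} → y ≢ 0# → x * y ≡ 0# → x ≡ 0#
  xy≡0⇒x≡0 {x} {y} y≢0 xy≡0 = xy≡0⇒y≡0 y≢0 (trans (*-comm y x) xy≡0)

  *-≢0 : ∀ {x y} → x ≢ 0# → y ≢ 0# → x * y ≢ 0#
  *-≢0 x≢0 y≢0 = y≢0 ∘ xy≡0⇒y≡0 x≢0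

  -‿≢0 : ∀ {x} → x ≢ 0# → - x ≢ 0#
  -‿≢0 {x} x≢0 -x≡0 = x≢0 (trans (sym (⁻¹-involutive x)) (trans (cong -_ -x≡0) ε⁻¹≈ε))

  ≢⇒-≢0 : ∀ {x y} → x ≢ y → x - y ≢ 0#
  ≢⇒-≢0 x≢y = x≢y ∘ x∙y⁻¹≈ε⇒x≈y _ _

  *-cancelˡ : ∀ {x y z} → x ≢ 0# → x * y ≡ x * z → y ≡ z
  *-cancelˡ {x} {y} {z} x≢0 eq = x∙y⁻¹≈ε⇒x≈y y z (xy≡0⇒y≡0 x≢0 (begin
    x * (y - z)  ≡⟨ solve 3 (λ x y z → x :* (y :- z) := x :* y :- x :* z) refl x y z ⟩
    x * y - x * z ≡⟨ x≈y⇒x∙y⁻¹≈ε eq ⟩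
    0#           ∎))

  Adj₅ : Vec Carrier 6 → Vec Carrier 6 → Set
  Adj₅ l r = at l 2 + at r 2 ≡ at r 0 * at l 0 × at l 3 + at r 3 ≡ at r 0 * at l 1
           × at l 4 + at r 4 ≡ at l 0 * at r 2 × at l 5 + at r 5 ≡ at l 0 * at r 3

  Adj⇔Adj₅ : ∀ {l r} → Adj 5 l r ⇔ Adj₅ l r
  Adj⇔Adj₅ = mk⇔ to from
    where
    to : ∀ {l r} → Adj 5 l r → Adj₅ l r
    to adj = adj 2 (≤ᵇ⇒≤ 2 2 _) (≤ᵇ⇒≤ 2 5 _) , adj 3 (≤ᵇ⇒≤ 2 3 _) (≤ᵇ⇒≤ 3 5 _)
           , adj 4 (≤ᵇ⇒≤ 2 4 _) (≤ᵇ⇒≤ 4 5 _) , adj 5 (≤ᵇ⇒≤ 2 5 _) (≤ᵇ⇒≤ 5 5 _)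
    from : ∀ {l r} → Adj₅ l r → Adj 5 l r
    from (e₂ , _  , _  , _ ) 2 _ _ = e₂
    from (_  , e₃ , _  , _ ) 3 _ _ = e₃
    from (_  , _  , e₄ , _ ) 4 _ _ = e₄
    from (_  , _  , _  , e₅) 5 _ _ = e₅
    from _ 0 () _
    from _ 1 (s≤s ()) _
    from _ (suc (suc (suc (suc (suc (suc _)))))) _ (s≤s (s≤s (s≤s (s≤s (s≤s ())))))

  x+[y-x]≡y : ∀ x y → x + (y - x) ≡ y
  x+[y-x]≡y x y = trans (+-comm x (y - x)) (//-rightDividesˡ x y)

  lNeighbour-adj : ∀ r x → Adj 5 (lNeighbour r x) r
  lNeighbour-adj (r₀ ∷ _ ∷ r₂ ∷ r₃ ∷ r₄ ∷ r₅ ∷ []) x = Equivalence.from Adj⇔Adj₅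
    (//-rightDividesˡ r₂ _ , //-rightDividesˡ r₃ _ , //-rightDividesˡ r₄ _ , //-rightDividesˡ r₅ _)

  rNeighbour-adj : ∀ l y → Adj 5 l (rNeighbour l y)
  rNeighbour-adj (_ ∷ _ ∷ l₂ ∷ l₃ ∷ l₄ ∷ l₅ ∷ []) y = Equivalence.from Adj⇔Adj₅
    (x+[y-x]≡y l₂ _ , x+[y-x]≡y l₃ _ , x+[y-x]≡y l₄ _ , x+[y-x]≡y l₅ _)

  lNeighbour-unique : ∀ {l r} → Adj 5 l r → InL l → l ≡ lNeighbour r (at l 0)
  lNeighbour-unique {l₀ ∷ l₁ ∷ l₂ ∷ l₃ ∷ l₄ ∷ l₅ ∷ []} {r₀ ∷ _ ∷ r₂ ∷ r₃ ∷ r₄ ∷ r₅ ∷ []}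
                    adj l₁≡l₂
    with Equivalence.to Adj⇔Adj₅ adj
  ... | e₂ , e₃ , e₄ , e₅ = Pointwise-≡⇒≡
    (refl ∷ l₁≡ ∷ l₂≡ ∷ trans (x≈z//y _ _ _ e₃) (cong (λ z → r₀ * z - r₃) l₁≡)
          ∷ x≈z//y _ _ _ e₄ ∷ x≈z//y _ _ _ e₅ ∷ [])
    where
    l₂≡ : l₂ ≡ r₀ * l₀ - r₂
    l₂≡ = x≈z//y _ _ _ e₂
    l₁≡ : l₁ ≡ r₀ * l₀ - r₂
    l₁≡ = trans l₁≡l₂ l₂≡

  rNeighbour-unique : ∀ {l r} → Adj 5 l r → InR r → r ≡ rNeighbour l (at r 0)
  rNeighbour-unique {l₀ ∷ l₁ ∷ l₂ ∷ l₃ ∷ l₄ ∷ l₅ ∷ []} {r₀ ∷ _ ∷ r₂ ∷ r₃ ∷ r₄ ∷ r₅ ∷ []}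
                    adj r₁≡0
    with Equivalence.to Adj⇔Adj₅ adj
  ... | e₂ , e₃ , e₄ , e₅ = Pointwise-≡⇒≡
    (refl ∷ r₁≡0 ∷ r₂≡ ∷ r₃≡ ∷ trans (solveʳ e₄) (cong (λ z → l₀ * z - l₄) r₂≡)
          ∷ trans (solveʳ e₅) (cong (λ z → l₀ * z - l₅) r₃≡) ∷ [])
    where
    solveʳ : ∀ {x y z} → x + y ≡ z → y ≡ z - x
    solveʳ eq = x≈z//y _ _ _ (trans (+-comm _ _) eq)
    r₂≡ : r₂ ≡ r₀ * l₀ - l₂
    r₂≡ = solveʳ e₂
    r₃≡ : r₃ ≡ r₀ * l₁ - l₃
    r₃≡ = solveʳ e₃

  Vanishing : Vec Carrier 6 → Set
  Vanishing r = at r 2 ≡ 0# × at r 3 ≡ 0# × at r 4 ≡ 0# × at r 5 ≡ 0#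

  Adj-origin⇔Vanishing : ∀ {r} → Adj 5 origin r ⇔ Vanishing r
  Adj-origin⇔Vanishing = mk⇔
    (λ adj → let e₂ , e₃ , e₄ , e₅ = Equivalence.to Adj⇔Adj₅ adj in
      vanish e₂ (zeroʳ _) , vanish e₃ (zeroʳ _) , vanish e₄ (zeroˡ _) , vanish e₅ (zeroˡ _))
    (λ (v₂ , v₃ , v₄ , v₅) → Equivalence.from Adj⇔Adj₅
      (adjacent v₂ (zeroʳ _) , adjacent v₃ (zeroʳ _) , adjacent v₄ (zeroˡ _) , adjacent v₅ (zeroˡ _)))
    where
    vanish : ∀ {x y} → 0# + x ≡ y → y ≡ 0# → x ≡ 0#
    vanish eq y≡0 = trans (sym (+-identityˡ _)) (trans eq y≡0)
    adjacent : ∀ {x y} → x ≡ 0# → y ≡ 0# → 0# + x ≡ y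
    adjacent x≡0 y≡0 = trans (+-identityˡ _) (trans x≡0 (sym y≡0))

  walk-cycle : ∀ {xs ys} → let open Walk xs ys in
    Vanishing r₅ → Injective _≡_ _≡_ ls → Injective _≡_ _≡_ rs → Cycle 5 4 ls rs
  walk-cycle {xs} {ys} vanishing ls-injective rs-injective = record
    { inL         = λ { 0F → refl ; 1F → refl ; 2F → refl ; 3F → refl ; 4F → refl }
    ; inR         = λ { 0F → refl ; 1F → refl ; 2F → refl ; 3F → refl ; 4F → refl }
    ; l1-zero     = refl
    ; r1-zero     = refl
    ; adj-lr      = λ { 0F → Equivalence.from Adj-origin⇔Vanishing (refl , refl , refl , refl)
                      ; 1F → rNeighbour-adj l₂ _ ; 2F → rNeighbour-adj l₃ _
                      ; 3F → rNeighbour-adj l₄ _ ; 4F → rNeighbour-adj l₅ _ }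
    ; adj-rl      = λ { 0F → lNeighbour-adj origin _ ; 1F → lNeighbour-adj r₂ _
                      ; 2F → lNeighbour-adj r₃ _ ; 3F → lNeighbour-adj r₄ _
                      ; 4F → Equivalence.from Adj-origin⇔Vanishing vanishing }
    ; ls-distinct = ls-injective
    ; rs-distinct = rs-injective
    }
    where open Walk xs ys

  Nondegenerate : Carrier → Carrier → Carrier → Set
  Nondegenerate b c r = b ≢ 0# × c ≢ 0# × r ≢ 0# × c ≢ - b × c ≢ - (b + b)

  standardU standardV : Carrier → Carrier → Carrier → Vec Carrier 5
  standardU b c r = c * r ∷ - (c * r) ∷ (b + c) * r ∷ - ((b + b + c) * r) ∷ b * r ∷ []
  standardV b c r = - (b + b) - c ∷ b ∷ c ∷ - c ∷ b + c ∷ []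

  differences : Vec Carrier 5 → Vec Carrier 5
  differences (x₁ ∷ x₂ ∷ x₃ ∷ x₄ ∷ x₅ ∷ []) =
    x₂ - x₁ ∷ x₃ - x₂ ∷ x₄ - x₃ ∷ x₅ - x₄ ∷ 0# - x₅ ∷ []

  module _ (b c r : Carrier) where
    private
      env : Vec Carrier 3
      env = b ∷ c ∷ r ∷ []
      B C R : Polynomial 3
      B = var 0F
      C = var 1F
      R = var 2F

    differences-standardX : differences (standardX b c r) ≡ standardU b c r
    differences-standardX = Pointwise-≡⇒≡
      ( prove env (C :* R :- :0) (C :* R) refl
      ∷ prove env (:0 :- C :* R) (:- (C :* R)) refl
      ∷ prove env ((B :+ C) :* R :- :0) ((B :+ C) :* R) refl
      ∷ prove env (:- (B :* R) :- (B :+ C) :* R) (:- ((B :+ B :+ C) :* R)) refl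
      ∷ prove env (:0 :- :- (B :* R)) (B :* R) refl
      ∷ [])

    differences-standardY : differences (standardY b c r) ≡ standardV b c r
    differences-standardY = Pointwise-≡⇒≡
      ( prove env (:- (B :+ C) :+ :- B :- :0) (:- (B :+ B) :- C) refl
      ∷ prove env (:- (B :+ C) :- (:- (B :+ C) :+ :- B)) B refl
      ∷ prove env (:- B :- :- (B :+ C)) C refl
      ∷ prove env (:- (B :+ C) :- :- B) (:- C) refl
      ∷ prove env (:0 :- :- (B :+ C)) (B :+ C) refl
      ∷ [])

  +≢0⇔≢- : ∀ {b c} → b + c ≢ 0# ⇔ c ≢ - b
  +≢0⇔≢- {b} {c} = mk⇔ (λ b+c≢0 c≡-b → b+c≢0 (trans (cong (b +_) c≡-b) (-‿inverseʳ b)))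
                         (λ c≢-b b+c≡0 → c≢-b (inverseʳ-unique b c b+c≡0))

  ≢-at : ∀ {u v : Vec Carrier 6} (k : Fin 6) {d} → lookup u k - lookup v k ≡ d → d ≢ 0# → u ≢ v
  ≢-at k eq d≢0 u≡v = d≢0 (trans (sym eq) (x≈y⇒x∙y⁻¹≈ε (cong (λ w → lookup w k) u≡v)))

  module StandardCycle {b c r : Carrier} (nondegenerate : Nondegenerate b c r) where
    open Standard b c r public

    private
      b≢0 : b ≢ 0#
      b≢0 = proj₁ nondegenerate
      c≢0 : c ≢ 0#
      c≢0 = proj₁ (proj₂ nondegenerate)
      r≢0 : r ≢ 0#
      r≢0 = proj₁ (proj₂ (proj₂ nondegenerate))
      b+c≢0 : b + c ≢ 0#
      b+c≢0 = Equivalence.from +≢0⇔≢- (proj₁ (proj₂ (proj₂ (proj₂ nondegenerate))))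
      b+b+c≢0 : b + b + c ≢ 0#
      b+b+c≢0 = Equivalence.from +≢0⇔≢- (proj₂ (proj₂ (proj₂ (proj₂ nondegenerate))))

      env : Vec Carrier 3
      env = b ∷ c ∷ r ∷ []
      B C R : Polynomial 3
      B = var 0F
      C = var 1F
      R = var 2F
      module 𝕊 = Formal.Standard B C R
      Δl Δr : Fin 5 → Fin 5 → Fin 6 → Polynomial 3
      Δl i j k = lookup (𝕊.ls i) k :- lookup (𝕊.ls j) k
      Δr i j k = lookup (𝕊.rs i) k :- lookup (𝕊.rs j) k

    vanishing : Vanishing r₅
    vanishing = prove env (lookup 𝕊.r₅ 2F) :0 refl , prove env (lookup 𝕊.r₅ 3F) :0 refl
              , prove env (lookup 𝕊.r₅ 4F) :0 refl , prove env (lookup 𝕊.r₅ 5F) :0 refl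

    ls-unique : Unique (tabulate ls)
    ls-unique =
        ( ≢-at 0F (prove env (Δl 0F 1F 0F) (:- (C :* R)) refl) (-‿≢0 (*-≢0 c≢0 r≢0))
        ∷ ≢-at 1F (prove env (Δl 0F 2F 1F) (:- ((B :+ B :+ C) :* (C :* R))) refl)
                  (-‿≢0 (*-≢0 b+b+c≢0 (*-≢0 c≢0 r≢0)))
        ∷ ≢-at 0F (prove env (Δl 0F 3F 0F) (:- ((B :+ C) :* R)) refl) (-‿≢0 (*-≢0 b+c≢0 r≢0))
        ∷ ≢-at 0F (prove env (Δl 0F 4F 0F) (B :* R) refl) (*-≢0 b≢0 r≢0) ∷ [])
      ∷ ( ≢-at 0F (prove env (Δl 1F 2F 0F) (C :* R) refl) (*-≢0 c≢0 r≢0)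
        ∷ ≢-at 0F (prove env (Δl 1F 3F 0F) (:- (B :* R)) refl) (-‿≢0 (*-≢0 b≢0 r≢0))
        ∷ ≢-at 0F (prove env (Δl 1F 4F 0F) ((B :+ C) :* R) refl) (*-≢0 b+c≢0 r≢0) ∷ [])
      ∷ ( ≢-at 0F (prove env (Δl 2F 3F 0F) (:- ((B :+ C) :* R)) refl) (-‿≢0 (*-≢0 b+c≢0 r≢0))
        ∷ ≢-at 0F (prove env (Δl 2F 4F 0F) (B :* R) refl) (*-≢0 b≢0 r≢0) ∷ [])
      ∷ ( ≢-at 0F (prove env (Δl 3F 4F 0F) ((B :+ B :+ C) :* R) refl) (*-≢0 b+b+c≢0 r≢0) ∷ [])
      ∷ [] ∷ []

    rs-unique : Unique (tabulate rs)
    rs-unique =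
        ( ≢-at 0F (prove env (Δr 0F 1F 0F) (B :+ B :+ C) refl) b+b+c≢0
        ∷ ≢-at 0F (prove env (Δr 0F 2F 0F) (B :+ C) refl) b+c≢0
        ∷ ≢-at 0F (prove env (Δr 0F 3F 0F) B refl) b≢0
        ∷ ≢-at 0F (prove env (Δr 0F 4F 0F) (B :+ C) refl) b+c≢0 ∷ [])
      ∷ ( ≢-at 0F (prove env (Δr 1F 2F 0F) (:- B) refl) (-‿≢0 b≢0)
        ∷ ≢-at 0F (prove env (Δr 1F 3F 0F) (:- (B :+ C)) refl) (-‿≢0 b+c≢0)
        ∷ ≢-at 0F (prove env (Δr 1F 4F 0F) (:- B) refl) (-‿≢0 b≢0) ∷ [])
      ∷ ( ≢-at 0F (prove env (Δr 2F 3F 0F) (:- C) refl) (-‿≢0 c≢0)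
        ∷ ≢-at 2F (prove env (Δr 2F 4F 2F) (:- ((B :+ B :+ C) :* (C :* R))) refl)
                  (-‿≢0 (*-≢0 b+b+c≢0 (*-≢0 c≢0 r≢0))) ∷ [])
      ∷ ( ≢-at 0F (prove env (Δr 3F 4F 0F) C refl) c≢0 ∷ [])
      ∷ [] ∷ []

    cycle : Cycle 5 4 ls rs
    cycle = walk-cycle vanishing (tabulate-unique⇒injective ls-unique) (tabulate-unique⇒injective rs-unique)

  standard⇒cycle : ∀ {b c r} → Nondegenerate b c r → HasCycleOfType 5 4 (standardU b c r) (standardV b c r)
  standard⇒cycle {b} {c} {r} nondegenerate =
    ls , rs , cycle , lookup-≡ (differences-standardX b c r) , lookup-≡ (differences-standardY b c r)
    where open StandardCycle nondegenerate

  standard-product≢0 : ∀ {b c r} → Nondegenerate b c r → (- (b + b) - c + (b + c)) * (- (b + b) - c + b) ≢ 0#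
  standard-product≢0 {b} {c} (b≢0 , _ , _ , c≢-b , _) =
    *-≢0 (-‿≢0 b≢0) (-‿≢0 (Equivalence.from +≢0⇔≢- c≢-b)) ∘ trans
      (solve 2 (λ b c → :- b :* :- (b :+ c) := (:- (b :+ b) :- c :+ (b :+ c)) :* (:- (b :+ b) :- c :+ b)) refl b c)

  elimination₁ : ∀ {s p q δ x y} → s ≢ 0# → p ≢ 0# → q ≢ 0# → x ≢ y →
    s * x * p + δ * y * q ≡ 0# → s * x * x * p + δ * y * y * q ≡ 0# → δ ≡ 0# × x ≡ 0#
  elimination₁ {s} {p} {q} {δ} {x} {y} s≢0 p≢0 q≢0 x≢y e₁ e₂ = δ≡0 , x≡0-if (δyq≡0 δ≡0)
    where
    x≡0-if : δ * y * q ≡ 0# → x ≡ 0#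
    x≡0-if δyq≡0 = xy≡0⇒y≡0 s≢0 (xy≡0⇒x≡0 p≢0 (begin
      s * x * p               ≡⟨ +-identityʳ _ ⟨
      s * x * p + 0#          ≡⟨ cong (λ z → s * x * p + z) δyq≡0 ⟨
      s * x * p + δ * y * q   ≡⟨ e₁ ⟩
      0#                      ∎))
    δyq≡0 : δ ≡ 0# → δ * y * q ≡ 0#
    δyq≡0 δ≡0 = begin
      δ * y * q     ≡⟨ cong (λ z → z * y * q) δ≡0 ⟩
      0# * y * q    ≡⟨ solve 2 (λ y q → :0 :* y :* q := :0) refl y q ⟩
      0#            ∎
    -- x·e₁ − e₂ factors, which separates δ from x.
    δyq[x-y]≡0 : δ * y * q * (x - y) ≡ 0#
    δyq[x-y]≡0 = begin
      δ * y * q * (x - y)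
        ≡⟨ solve 6 (λ s p q δ x y → δ :* y :* q :* (x :- y)
                      := x :* (s :* x :* p :+ δ :* y :* q) :- (s :* x :* x :* p :+ δ :* y :* y :* q))
                   refl s p q δ x y ⟩
      x * (s * x * p + δ * y * q) - (s * x * x * p + δ * y * y * q)
        ≡⟨ cong₂ (λ u v → x * u - v) e₁ e₂ ⟩
      x * 0# - 0#
        ≡⟨ solve 1 (λ x → x :* :0 :- :0 := :0) refl x ⟩
      0# ∎
    y≢0 : y ≢ 0#
    y≢0 y≡0 = x≢y (trans (x≡0-if (begin
      δ * y * q     ≡⟨ cong (λ z → δ * z * q) y≡0 ⟩
      δ * 0# * q    ≡⟨ solve 2 (λ δ q → δ :* :0 :* q := :0) refl δ q ⟩
      0#            ∎)) (sym y≡0))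
    δ≡0 : δ ≡ 0#
    δ≡0 = xy≡0⇒x≡0 y≢0 (xy≡0⇒x≡0 q≢0 (xy≡0⇒x≡0 (≢⇒-≢0 x≢y) δyq[x-y]≡0))

  elimination₂ : ∀ {s t q x₂ x₄ x₅} → s + t ≢ 0# → q ≢ 0# → x₄ ≢ x₅ →
    (s + t) * x₂ + q * (x₄ - x₅) ≡ 0# → q * (t * x₄ + s * x₅) * (x₄ - x₅) ≡ 0# →
    t * x₄ + s * x₅ ≡ 0# × t * x₂ ≡ q * x₅
  elimination₂ {s} {t} {q} {x₂} {x₄} {x₅} s+t≢0 q≢0 x₄≢x₅ e₁ e₂ =
    e₃ , x∙y⁻¹≈ε⇒x≈y _ _ (xy≡0⇒y≡0 s+t≢0 (begin
      (s + t) * (t * x₂ - q * x₅)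
        ≡⟨ solve 6 (λ s t q x₂ x₄ x₅ → (s :+ t) :* (t :* x₂ :- q :* x₅)
                      := t :* ((s :+ t) :* x₂ :+ q :* (x₄ :- x₅)) :- q :* (t :* x₄ :+ s :* x₅))
                   refl s t q x₂ x₄ x₅ ⟩
      t * ((s + t) * x₂ + q * (x₄ - x₅)) - q * (t * x₄ + s * x₅)
        ≡⟨ cong₂ (λ u v → t * u - q * v) e₁ e₃ ⟩
      t * 0# - q * 0#
        ≡⟨ solve 2 (λ t q → t :* :0 :- q :* :0 := :0) refl t q ⟩
      0# ∎))
    where
    e₃ : t * x₄ + s * x₅ ≡ 0#
    e₃ = xy≡0⇒y≡0 q≢0 (xy≡0⇒x≡0 (≢⇒-≢0 x₄≢x₅) e₂)

  closing-equations : ∀ x₂ x₃ x₄ x₅ y₂ y₃ y₄ →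
    Vanishing (endpoint (0# ∷ x₂ ∷ x₃ ∷ x₄ ∷ x₅ ∷ []) (0# ∷ y₂ ∷ y₃ ∷ y₄ ∷ y₂ - y₄ ∷ [])) →
    y₃ * x₃ * (y₃ - y₂) + (y₃ + y₄ - y₂) * x₄ * (y₄ - y₃) ≡ 0#
    × y₃ * x₃ * x₃ * (y₃ - y₂) + (y₃ + y₄ - y₂) * x₄ * x₄ * (y₄ - y₃) ≡ 0#
  closing-equations x₂ x₃ x₄ x₅ y₂ y₃ y₄ (e₂ , e₃ , e₄ , e₅) =
    (begin
      y₃ * x₃ * (y₃ - y₂) + (y₃ + y₄ - y₂) * x₄ * (y₄ - y₃)
        ≡⟨ prove ρ (Y₃ :* X₃ :* (Y₃ :- Y₂) :+ (Y₃ :+ Y₄ :- Y₂) :* X₄ :* (Y₄ :- Y₃))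
                   (ê 3F :- Y₄ :* ê 2F) refl ⟩
      at e 3 - y₄ * at e 2
        ≡⟨ cong₂ (λ u v → u - y₄ * v) e₃ e₂ ⟩
      0# - y₄ * 0#
        ≡⟨ solve 1 (λ y → :0 :- y :* :0 := :0) refl y₄ ⟩
      0# ∎) ,
    (begin
      y₃ * x₃ * x₃ * (y₃ - y₂) + (y₃ + y₄ - y₂) * x₄ * x₄ * (y₄ - y₃)
        ≡⟨ prove ρ (Y₃ :* X₃ :* X₃ :* (Y₃ :- Y₂) :+ (Y₃ :+ Y₄ :- Y₂) :* X₄ :* X₄ :* (Y₄ :- Y₃))
                   (ê 5F :+ ê 5F :- Y₂ :* ê 4F :+ ê 2F :* ê 2F) refl ⟩
      at e 5 + at e 5 - y₂ * at e 4 + at e 2 * at e 2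
        ≡⟨ cong₂ (λ u v → u + u - y₂ * v + at e 2 * at e 2) e₅ e₄ ⟩
      0# + 0# - y₂ * 0# + at e 2 * at e 2
        ≡⟨ cong (λ u → 0# + 0# - y₂ * 0# + u * u) e₂ ⟩
      0# + 0# - y₂ * 0# + 0# * 0#
        ≡⟨ solve 1 (λ y → :0 :+ :0 :- y :* :0 :+ :0 :* :0 := :0) refl y₂ ⟩
      0# ∎)
    where
    e = endpoint (0# ∷ x₂ ∷ x₃ ∷ x₄ ∷ x₅ ∷ []) (0# ∷ y₂ ∷ y₃ ∷ y₄ ∷ y₂ - y₄ ∷ [])
    ρ = x₂ ∷ x₃ ∷ x₄ ∷ x₅ ∷ y₂ ∷ y₃ ∷ y₄ ∷ []
    X₂ X₃ X₄ X₅ Y₂ Y₃ Y₄ : Polynomial 7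
    X₂ = var 0F
    X₃ = var 1F
    X₄ = var 2F
    X₅ = var 3F
    Y₂ = var 4F
    Y₃ = var 5F
    Y₄ = var 6F
    ê : Fin 6 → Polynomial 7
    ê = lookup (Formal.endpoint (:0 ∷ X₂ ∷ X₃ ∷ X₄ ∷ X₅ ∷ [])
                                (:0 ∷ Y₂ ∷ Y₃ ∷ Y₄ ∷ Y₂ :- Y₄ ∷ []))

  closing-equations′ : ∀ x₂ x₄ x₅ y₃ y₄ →
    Vanishing (endpoint (0# ∷ x₂ ∷ 0# ∷ x₄ ∷ x₅ ∷ []) (0# ∷ y₃ + y₄ ∷ y₃ ∷ y₄ ∷ y₃ + y₄ - y₄ ∷ [])) →
    (y₃ + y₄) * x₂ + (y₄ - y₃) * (x₄ - x₅) ≡ 0#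
    × (y₄ - y₃) * (y₄ * x₄ + y₃ * x₅) * (x₄ - x₅) ≡ 0#
  closing-equations′ x₂ x₄ x₅ y₃ y₄ (e₂ , _ , _ , e₅) =
    trans (sym c₂≡) e₂ ,
    (begin
      (y₄ - y₃) * (y₄ * x₄ + y₃ * x₅) * (x₄ - x₅)
        ≡⟨ prove ρ ((Y₄ :- Y₃) :* (Y₄ :* X₄ :+ Y₃ :* X₅) :* (X₄ :- X₅))
                   (ê 5F :+ ê 2F :* (Y₄ :- Y₃) :* (X₄ :- X₅)) refl ⟩
      at e 5 + at e 2 * (y₄ - y₃) * (x₄ - x₅)
        ≡⟨ cong₂ (λ u v → u + v * (y₄ - y₃) * (x₄ - x₅)) e₅ e₂ ⟩
      0# + 0# * (y₄ - y₃) * (x₄ - x₅)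
        ≡⟨ solve 2 (λ u v → :0 :+ :0 :* u :* v := :0) refl (y₄ - y₃) (x₄ - x₅) ⟩
      0# ∎)
    where
    e = endpoint (0# ∷ x₂ ∷ 0# ∷ x₄ ∷ x₅ ∷ []) (0# ∷ y₃ + y₄ ∷ y₃ ∷ y₄ ∷ y₃ + y₄ - y₄ ∷ [])
    ρ = x₂ ∷ x₄ ∷ x₅ ∷ y₃ ∷ y₄ ∷ []
    X₂ X₄ X₅ Y₃ Y₄ : Polynomial 5
    X₂ = var 0F
    X₄ = var 1F
    X₅ = var 2F
    Y₃ = var 3F
    Y₄ = var 4F
    ê : Fin 6 → Polynomial 5
    ê = lookup (Formal.endpoint (:0 ∷ X₂ ∷ :0 ∷ X₄ ∷ X₅ ∷ [])
                                (:0 ∷ Y₃ :+ Y₄ ∷ Y₃ ∷ Y₄ ∷ Y₃ :+ Y₄ :- Y₄ ∷ []))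
    c₂≡ : at e 2 ≡ (y₃ + y₄) * x₂ + (y₄ - y₃) * (x₄ - x₅)
    c₂≡ = prove ρ (ê 2F) ((Y₃ :+ Y₄) :* X₂ :+ (Y₄ :- Y₃) :* (X₄ :- X₅)) refl

  closing-relations : ∀ {x₂ x₃ x₄ x₅ y₂ y₃ y₄} →
    y₂ ≢ 0# → y₃ ≢ 0# → y₃ ≢ y₂ → y₄ ≢ y₃ → x₃ ≢ x₄ → x₄ ≢ x₅ →
    Vanishing (endpoint (0# ∷ x₂ ∷ x₃ ∷ x₄ ∷ x₅ ∷ []) (0# ∷ y₂ ∷ y₃ ∷ y₄ ∷ y₂ - y₄ ∷ [])) →
    y₂ ≡ y₃ + y₄ × x₃ ≡ 0# × y₄ * x₄ + y₃ * x₅ ≡ 0# × y₄ * x₂ ≡ (y₄ - y₃) * x₅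
  closing-relations {x₂} {x₃} {x₄} {x₅} {y₂} {y₃} {y₄} y₂≢0 y₃≢0 y₃≢y₂ y₄≢y₃ x₃≢x₄ x₄≢x₅ vanishing =
    y₂≡ , x₃≡0 , uncurry (elimination₂ (y₂≢0 ∘ trans y₂≡) (≢⇒-≢0 y₄≢y₃) x₄≢x₅)
                         (closing-equations′ x₂ x₄ x₅ y₃ y₄ vanishing′)
    where
    eliminated : y₃ + y₄ - y₂ ≡ 0# × x₃ ≡ 0#
    eliminated = uncurry (elimination₁ y₃≢0 (≢⇒-≢0 y₃≢y₂) (≢⇒-≢0 y₄≢y₃) x₃≢x₄)
                         (closing-equations x₂ x₃ x₄ x₅ y₂ y₃ y₄ vanishing)
    y₂≡ : y₂ ≡ y₃ + y₄
    y₂≡ = sym (x∙y⁻¹≈ε⇒x≈y _ _ (proj₁ eliminated))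
    x₃≡0 : x₃ ≡ 0#
    x₃≡0 = proj₂ eliminated
    vanishing′ : Vanishing (endpoint (0# ∷ x₂ ∷ 0# ∷ x₄ ∷ x₅ ∷ []) (0# ∷ y₃ + y₄ ∷ y₃ ∷ y₄ ∷ y₃ + y₄ - y₄ ∷ []))
    vanishing′ = subst₂ (λ u v → Vanishing (endpoint (0# ∷ x₂ ∷ v ∷ x₄ ∷ x₅ ∷ [])
                                                     (0# ∷ u ∷ y₃ ∷ y₄ ∷ u - y₄ ∷ [])))
                        y₂≡ x₃≡0 vanishing

  standard-parameters : ∀ {x₁ x₂ x₃ x₄ x₅ y₁ y₂ y₃ y₄ y₅} →
    x₁ ≡ 0# → y₁ ≡ 0# → y₂ ≡ y₃ + y₄ → y₅ ≡ y₃ → x₃ ≡ 0# →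
    y₄ * x₄ + y₃ * x₅ ≡ 0# → y₄ * x₂ ≡ (y₄ - y₃) * x₅ →
    y₂ ≢ 0# → y₃ ≢ 0# → y₄ ≢ 0# → y₄ ≢ y₃ → x₅ ≢ 0# →
    Σ[ b ∈ Carrier ] Σ[ c ∈ Carrier ] Σ[ r ∈ Carrier ] Nondegenerate b c r
      × x₁ ∷ x₂ ∷ x₃ ∷ x₄ ∷ x₅ ∷ [] ≡ standardX b c r × y₁ ∷ y₂ ∷ y₃ ∷ y₄ ∷ y₅ ∷ [] ≡ standardY b c r
  standard-parameters {x₂ = x₂} {x₄ = x₄} {x₅ = x₅} {y₃ = y₃} {y₄ = y₄}
    refl refl refl refl refl e₁ e₂ y₂≢0 y₃≢0 y₄≢0 y₄≢y₃ x₅≢0 with inverse y₄ y₄≢0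
  ... | y₄⁻¹ , y₄y₄⁻¹≡1 = - y₄ , y₄ - y₃ , r , nondegenerate , xs≡ , ys≡
    where
    r = y₄⁻¹ * x₅
    env = y₃ ∷ y₄ ∷ r ∷ []
    Y₃ Y₄ R : Polynomial 3
    Y₃ = var 0F
    Y₄ = var 1F
    R = var 2F

    y₄r≡x₅ : y₄ * r ≡ x₅
    y₄r≡x₅ = begin
      y₄ * (y₄⁻¹ * x₅)  ≡⟨ *-assoc y₄ y₄⁻¹ x₅ ⟨
      y₄ * y₄⁻¹ * x₅    ≡⟨ cong (_* x₅) y₄y₄⁻¹≡1 ⟩
      1# * x₅           ≡⟨ *-identityˡ x₅ ⟩
      x₅                ∎
    x₂≡ : x₂ ≡ (y₄ - y₃) * r
    x₂≡ = *-cancelˡ y₄≢0 (begin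
      y₄ * x₂               ≡⟨ e₂ ⟩
      (y₄ - y₃) * x₅        ≡⟨ cong ((y₄ - y₃) *_) y₄r≡x₅ ⟨
      (y₄ - y₃) * (y₄ * r)  ≡⟨ prove env ((Y₄ :- Y₃) :* (Y₄ :* R)) (Y₄ :* ((Y₄ :- Y₃) :* R)) refl ⟩
      y₄ * ((y₄ - y₃) * r)  ∎)
    x₄≡ : x₄ ≡ (- y₄ + (y₄ - y₃)) * r
    x₄≡ = *-cancelˡ y₄≢0 (begin
      y₄ * x₄                      ≡⟨ inverseˡ-unique _ _ e₁ ⟩
      - (y₃ * x₅)                  ≡⟨ cong (λ z → - (y₃ * z)) y₄r≡x₅ ⟨
      - (y₃ * (y₄ * r))
        ≡⟨ prove env (:- (Y₃ :* (Y₄ :* R))) (Y₄ :* ((:- Y₄ :+ (Y₄ :- Y₃)) :* R)) refl ⟩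
      y₄ * ((- y₄ + (y₄ - y₃)) * r) ∎)
    x₅≡ : x₅ ≡ - (- y₄ * r)
    x₅≡ = trans (sym y₄r≡x₅) (prove env (Y₄ :* R) (:- (:- Y₄ :* R)) refl)

    xs≡ : 0# ∷ x₂ ∷ 0# ∷ x₄ ∷ x₅ ∷ [] ≡ standardX (- y₄) (y₄ - y₃) r
    xs≡ = Pointwise-≡⇒≡ (refl ∷ x₂≡ ∷ refl ∷ x₄≡ ∷ x₅≡ ∷ [])
    ys≡ : 0# ∷ y₃ + y₄ ∷ y₃ ∷ y₄ ∷ y₃ ∷ [] ≡ standardY (- y₄) (y₄ - y₃) r
    ys≡ = Pointwise-≡⇒≡
      ( refl
      ∷ prove env (Y₃ :+ Y₄) (:- (:- Y₄ :+ (Y₄ :- Y₃)) :+ :- :- Y₄) refl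
      ∷ prove env Y₃ (:- (:- Y₄ :+ (Y₄ :- Y₃))) refl
      ∷ prove env Y₄ (:- :- Y₄) refl
      ∷ prove env Y₃ (:- (:- Y₄ :+ (Y₄ :- Y₃))) refl
      ∷ [])

    nondegenerate : Nondegenerate (- y₄) (y₄ - y₃) r
    nondegenerate =
        -‿≢0 y₄≢0
      , ≢⇒-≢0 y₄≢y₃
      , (λ r≡0 → x₅≢0 (trans (sym y₄r≡x₅) (trans (cong (y₄ *_) r≡0) (zeroʳ y₄))))
      , Equivalence.to +≢0⇔≢- (y₃≢0 ∘ trans (prove env Y₃ (:- (:- Y₄ :+ (Y₄ :- Y₃))) refl) ∘ -‿≡0)
      , Equivalence.to +≢0⇔≢-
          (y₂≢0 ∘ trans (prove env (Y₃ :+ Y₄) (:- (:- Y₄ :+ :- Y₄ :+ (Y₄ :- Y₃))) refl) ∘ -‿≡0)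
      where
      -‿≡0 : ∀ {x} → x ≡ 0# → - x ≡ 0#
      -‿≡0 x≡0 = trans (cong -_ x≡0) ε⁻¹≈ε

  type-conditions : ∀ {y₁ y₂ y₃ y₄ y₅} → y₁ ≡ 0# →
    ((y₂ - y₁) + (0# - y₅)) * ((y₂ - y₁) + (y₃ - y₂)) ≢ 0# → 0# - y₅ ≡ (y₃ - y₂) + (y₄ - y₃) →
    y₅ ≡ y₂ - y₄ × y₃ ≢ 0# × y₄ ≢ 0#
  type-conditions {y₂ = y₂} {y₃} {y₄} {y₅} refl product≢0 v₅≡v₂+v₃ =
    y₅≡ , (λ y₃≡0 → y₄y₃≢0 (trans (cong (y₄ *_) y₃≡0) (zeroʳ y₄)))
        , (λ y₄≡0 → y₄y₃≢0 (trans (cong (_* y₃) y₄≡0) (zeroˡ y₃)))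
    where
    env = y₂ ∷ y₃ ∷ y₄ ∷ y₅ ∷ []
    Y₂ Y₃ Y₄ Y₅ : Polynomial 4
    Y₂ = var 0F
    Y₃ = var 1F
    Y₄ = var 2F
    Y₅ = var 3F
    y₅≡ : y₅ ≡ y₂ - y₄
    y₅≡ = begin
      y₅                            ≡⟨ prove env Y₅ (:- (:0 :- Y₅)) refl ⟩
      - (0# - y₅)                   ≡⟨ cong -_ v₅≡v₂+v₃ ⟩
      - ((y₃ - y₂) + (y₄ - y₃))     ≡⟨ prove env (:- ((Y₃ :- Y₂) :+ (Y₄ :- Y₃))) (Y₂ :- Y₄) refl ⟩
      y₂ - y₄                       ∎
    y₄y₃≢0 : y₄ * y₃ ≢ 0#
    y₄y₃≢0 = product≢0 ∘ trans (begin
      ((y₂ - 0#) + (0# - y₅)) * ((y₂ - 0#) + (y₃ - y₂))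
        ≡⟨ cong (λ z → ((y₂ - 0#) + (0# - z)) * ((y₂ - 0#) + (y₃ - y₂))) y₅≡ ⟩
      ((y₂ - 0#) + (0# - (y₂ - y₄))) * ((y₂ - 0#) + (y₃ - y₂))
        ≡⟨ prove env ((Y₂ :- :0 :+ (:0 :- (Y₂ :- Y₄))) :* (Y₂ :- :0 :+ (Y₃ :- Y₂))) (Y₄ :* Y₃) refl ⟩
      y₄ * y₃ ∎)

  module CycleAnalysis {ls rs : Fin 5 → Vec Carrier 6} (cycle : Cycle 5 4 ls rs) where
    open Cycle cycle

    x y : Fin 5 → Carrier
    x i = at (ls i) 0
    y i = at (rs i) 0

    x₁≡0 : x 0F ≡ 0#
    x₁≡0 = cong (λ v → at v 0) l1-zero

    y₁≡0 : y 0F ≡ 0#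
    y₁≡0 = cong (λ v → at v 0) r1-zero

    next-≢ : ∀ (i : Fin 5) → next i ≢ i
    next-≢ 0F ()
    next-≢ 1F ()
    next-≢ 2F ()
    next-≢ 3F ()
    next-≢ 4F ()

    x-next-≢ : ∀ i → x (next i) ≢ x i
    x-next-≢ i eq = next-≢ i (ls-distinct (begin
      ls (next i)                     ≡⟨ lNeighbour-unique (adj-rl i) (inL (next i)) ⟩
      lNeighbour (rs i) (x (next i))  ≡⟨ cong (lNeighbour (rs i)) eq ⟩
      lNeighbour (rs i) (x i)         ≡⟨ lNeighbour-unique (adj-lr i) (inL i) ⟨
      ls i                            ∎))

    y-next-≢ : ∀ i → y (next i) ≢ y i
    y-next-≢ i eq = next-≢ i (rs-distinct (begin
      rs (next i)                     ≡⟨ rNeighbour-unique (adj-lr (next i)) (inR (next i)) ⟩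
      rNeighbour (ls (next i)) (y (next i)) ≡⟨ cong (rNeighbour (ls (next i))) eq ⟩
      rNeighbour (ls (next i)) (y i)  ≡⟨ rNeighbour-unique (adj-rl i) (inR i) ⟨
      rs i                            ∎))

    y₂≢0 : y 1F ≢ 0#
    y₂≢0 y₂≡0 = y-next-≢ 0F (trans y₂≡0 (sym y₁≡0))

    x₅≢0 : x 4F ≢ 0#
    x₅≢0 x₅≡0 = x-next-≢ 4F (trans x₁≡0 (sym x₅≡0))

    y₅≡y₃ : y 4F ≡ y 1F - y 3F → y 1F ≡ y 2F + y 3F → y 4F ≡ y 2F
    y₅≡y₃ y₅≡ y₂≡ = trans y₅≡ (trans (cong (_- y 3F) y₂≡) (//-rightDividesʳ (y 3F) (y 2F)))

    vanishing : Vanishing (endpoint (0# ∷ x 1F ∷ x 2F ∷ x 3F ∷ x 4F ∷ []) (0# ∷ y 1F ∷ y 2F ∷ y 3F ∷ y 4F ∷ []))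
    vanishing = Equivalence.to Adj-origin⇔Vanishing (subst₂ (Adj 5) l1-zero rs₅≡ (adj-rl 4F))
      where
      followL : ∀ i {r} → rs i ≡ r → ls (next i) ≡ lNeighbour r (x (next i))
      followL i eq = trans (lNeighbour-unique (adj-rl i) (inL (next i))) (cong (λ r → lNeighbour r _) eq)
      followR : ∀ i {l} → ls i ≡ l → rs i ≡ rNeighbour l (y i)
      followR i eq = trans (rNeighbour-unique (adj-lr i) (inR i)) (cong (λ l → rNeighbour l _) eq)
      rs₅≡ : rs 4F ≡ endpoint (0# ∷ x 1F ∷ x 2F ∷ x 3F ∷ x 4F ∷ []) (0# ∷ y 1F ∷ y 2F ∷ y 3F ∷ y 4F ∷ [])
      rs₅≡ = followR 4F (followL 3F (followR 3F (followL 2F (followR 2F (followL 1F (followR 1F (followL 0F r1-zero)))))))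

    cycle-type-standard : (vOf rs 0F + vOf rs 4F) * (vOf rs 0F + vOf rs 1F) ≢ 0# → vOf rs 4F ≡ vOf rs 1F + vOf rs 2F →
      Σ[ b ∈ Carrier ] Σ[ c ∈ Carrier ] Σ[ r ∈ Carrier ] Nondegenerate b c r
        × tabulate (uOf ls) ≡ standardU b c r × tabulate (vOf rs) ≡ standardV b c r
    -- Irrefutable let patterns instead of with: with-abstraction would traverse the
    -- normal forms of the walk and exhaust memory.
    cycle-type-standard product≢0 v₅≡v₂+v₃ =
      let y₅≡ , y₃≢0 , y₄≢0 = type-conditions y₁≡0 product≢0 v₅≡v₂+v₃
          y₂≡ , x₃≡0 , e₁ , e₂ = closing-relations y₂≢0 y₃≢0 (y-next-≢ 1F) (y-next-≢ 2F)
            (≢-sym (x-next-≢ 2F)) (≢-sym (x-next-≢ 3F)) (subst Vanishing′ y₅≡ vanishing)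
          b , c , r , nondegenerate , xs≡ , ys≡ = standard-parameters x₁≡0 y₁≡0 y₂≡ (y₅≡y₃ y₅≡ y₂≡) x₃≡0
            e₁ e₂ y₂≢0 y₃≢0 y₄≢0 (y-next-≢ 2F) x₅≢0
      in b , c , r , nondegenerate , trans (cong differences xs≡) (differences-standardX b c r)
                                   , trans (cong differences ys≡) (differences-standardY b c r)
      where
      Vanishing′ : Carrier → Set
      Vanishing′ y₅ =
        Vanishing (endpoint (0# ∷ x 1F ∷ x 2F ∷ x 3F ∷ x 4F ∷ []) (0# ∷ y 1F ∷ y 2F ∷ y 3F ∷ y₅ ∷ []))

  cycle⇒standard : ∀ {u₁ u₂ u₃ u₄ u₅ v₁ v₂ v₃ v₄ v₅} →
    HasCycleOfType 5 4 (u₁ ∷ u₂ ∷ u₃ ∷ u₄ ∷ u₅ ∷ []) (v₁ ∷ v₂ ∷ v₃ ∷ v₄ ∷ v₅ ∷ []) →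
    (v₁ + v₅) * (v₁ + v₂) ≢ 0# → v₅ ≡ v₂ + v₃ →
    Σ[ b ∈ Carrier ] Σ[ c ∈ Carrier ] Σ[ r ∈ Carrier ] Nondegenerate b c r
      × u₁ ∷ u₂ ∷ u₃ ∷ u₄ ∷ u₅ ∷ [] ≡ standardU b c r × v₁ ∷ v₂ ∷ v₃ ∷ v₄ ∷ v₅ ∷ [] ≡ standardV b c r
  cycle⇒standard (ls , rs , cycle , hu , hv) product≢0 v₅≡v₂+v₃ with hv 0F | hv 1F | hv 2F | hv 4F
  ... | refl | refl | refl | refl =
    let b , c , r , nondegenerate , u≡ , v≡ = CycleAnalysis.cycle-type-standard cycle product≢0 v₅≡v₂+v₃
    in b , c , r , nondegenerate , trans (sym (tabulate-≡ hu)) u≡ , trans (sym (tabulate-≡ hv)) v≡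

lemma4 : (q : ℕ) → IsPrimePower q → (F : FiniteField q) →
    let open Lambda F in
    (u₁ v₁ u₂ v₂ u₃ v₃ u₄ v₄ u₅ v₅ : Carrier) →
    (HasCycleOfType 5 4 (u₁ ∷ u₂ ∷ u₃ ∷ u₄ ∷ u₅ ∷ []) (v₁ ∷ v₂ ∷ v₃ ∷ v₄ ∷ v₅ ∷ [])
       × (v₁ + v₅) * (v₁ + v₂) ≢ 0# × v₅ ≡ v₂ + v₃)
    ⇔ Σ Carrier (λ b → Σ Carrier (λ c → Σ Carrier (λ r →
         b ≢ 0# × c ≢ 0# × r ≢ 0# × c ≢ - b × c ≢ - (b + b)
         × v₁ ≡ - (b + b) - c × v₂ ≡ b × v₃ ≡ c × v₄ ≡ - c × v₅ ≡ b + c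
         × u₁ ≡ c * r × u₂ ≡ - (c * r) × u₃ ≡ (b + c) * r
         × u₄ ≡ - ((b + b + c) * r) × u₅ ≡ b * r)))
lemma4 q _ F _ _ _ _ _ _ _ _ _ _ = mk⇔
  (λ { (cycle , product≢0 , v₅≡v₂+v₃) → case cycle⇒standard cycle product≢0 v₅≡v₂+v₃ of λ where
         (b , c , r , (b≢0 , c≢0 , r≢0 , c≢-b , c≢-2b) , ≡.refl , ≡.refl) →
           b , c , r , b≢0 , c≢0 , r≢0 , c≢-b , c≢-2b
             , ≡.refl , ≡.refl , ≡.refl , ≡.refl , ≡.refl , ≡.refl , ≡.refl , ≡.refl , ≡.refl , ≡.refl })
  (λ { (b , c , r , b≢0 , c≢0 , r≢0 , c≢-b , c≢-2b
         , ≡.refl , ≡.refl , ≡.refl , ≡.refl , ≡.refl , ≡.refl , ≡.refl , ≡.refl , ≡.refl , ≡.refl) →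
         let nondegenerate = b≢0 , c≢0 , r≢0 , c≢-b , c≢-2b in
         standard⇒cycle nondegenerate , standard-product≢0 nondegenerate , ≡.refl })
  where open Λ₅ F
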